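{- Let $n$ be a positive integer and let $a,b$ be integers with $0<a<b$, regarded as elements of $\mathbb{Z}_n$. Consider the multisets of elements of $\mathbb{Z}_n$ $$\mathcal{W}=\{0,a,b,2b,b+a,b-a,2b-a,2b-2a,3b-a,3b-2a,2b+a,3b\},$$ $$\mathcal{B}=\{0,a,b,2b,b+a,b-a,2b-a,2b-2a,3b-a,3b-2a,-a,b-2a\}.$$ Suppose all 12 elements of $\mathcal{W}$ are pairwise distinct in $\mathbb{Z}_n$, and all 12 elements of $\mathcal{B}$ are pairwise distinct in $\mathbb{Z}_n$. Then the cyclic Haar graph $H(n,\{0,a,b\})$ is splittable. More precisely, $$\Sigma=\{0^+,(2b)^+,(2b-2a)^+,(b-a)^-,(b+a)^-,(3b-a)^-\}$$ is a splitting set for $H(n,\{0,a,b\})$.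
   Context: For a positive integer $n$ and $S\subseteq\mathbb{Z}_n$, the cyclic Haar graph $H(n,S)$ has vertex set $\{i^+: i\in\mathbb{Z}_n\}\cup\{i^-: i\in\mathbb{Z}_n\}$. Its edges join $i^+$ to $(i+k)^-$ for each $i\in\mathbb{Z}_n$ and each $k\in S$. For a graph $G$, the square $G^2$ has the same vertex set, and two distinct vertices are adjacent in $G^2$ iff their distance in $G$ is at most 2. A connected graph $G$ is splittable if there is a set $\Sigma\subseteq V(G)$ that is independent in $G^2$ and such that $G-\Sigma$ is disconnected. Such a $\Sigma$ is called a splitting set. -}

module Defs where

open import Data.Nat using (ℕ; NonZero) renaming (_+_ to _ℕ+_)
open import Data.Integer using (ℤ; +_; _%ℕ_)
open import Data.Integer.DivMod using (n%ℕd<d)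
open import Data.Fin using (Fin; toℕ; fromℕ<)
open import Data.Product using (Σ; ∃; _×_; _,_)
open import Data.List using (List)
open import Data.List.Membership.Propositional using (_∈_)
open import Data.Empty using (⊥)
open import Relation.Nullary using (¬_)
open import Relation.Binary.PropositionalEquality using (_≡_; _≢_)

-- ℤ_n, represented by Fin n, with the reduction map ℤ → ℤ_n

ι : {n : ℕ} .{{_ : NonZero n}} → ℤ → Fin n
ι {n} z = fromℕ< (n%ℕd<d z n)

_+ₙ_ : {n : ℕ} .{{_ : NonZero n}} → Fin n → Fin n → Fin n
i +ₙ k = ι (+ (toℕ i ℕ+ toℕ k))

module _ {V : Set} (E : V → V → Set) where

  data Reach (Allowed : V → Set) : V → V → Set where
    here : ∀ {u} → Reach Allowed u u
    step : ∀ {u v w} → Allowed v → E u v → Reach Allowed v w → Reach Allowed u w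

  Connected : Set
  Connected = ∀ u v → Reach (λ _ → V) u v

  DisconnectedWithout : (V → Set) → Set
  DisconnectedWithout Sig =
    Σ V λ u → Σ V λ v → ¬ Sig u × ¬ Sig v × ¬ Reach (λ x → ¬ Sig x) u v

  Adj² : V → V → Set
  Adj² u v = u ≢ v × (E u v ⊎' (Σ V λ w → E u w × E w v))
    where
    open import Data.Sum using () renaming (_⊎_ to _⊎'_)

  IndependentSq : (V → Set) → Set
  IndependentSq Sig = ∀ u v → Sig u → Sig v → ¬ Adj² u v

  IsSplittingSet : (V → Set) → Set
  IsSplittingSet Sig = IndependentSq Sig × DisconnectedWithout Sig

  Splittable : Set₁
  Splittable = Connected × Σ (V → Set) IsSplittingSet

data Sign : Set where
  plus minus : Sign

HVertex : ℕ → Set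
HVertex n = Sign × Fin n

HAdj : (n : ℕ) .{{_ : NonZero n}} → List (Fin n) → HVertex n → HVertex n → Set
HAdj n S (plus  , i) (minus , j) = Σ (Fin n) λ k → k ∈ S × j ≡ i +ₙ k
HAdj n S (minus , j) (plus  , i) = Σ (Fin n) λ k → k ∈ S × j ≡ i +ₙ k
HAdj n S (plus  , _) (plus  , _) = ⊥
HAdj n S (minus , _) (minus , _) = ⊥

InList : {A : Set} → List A → A → Set
InList xs x = x ∈ xs

-- Every vertex relevant to the argument has an index of the form α a + β b, so
-- we label it by the lattice point (α , β) ∈ ℤ²; the edges i⁺ ~ (i+k)⁻ become
-- p⁺ ~ (p + K)⁻ for K ∈ {(0,0), (1,0), (0,1)}.  Two lattice vertices certainly
-- have distinct realisations when their signs differ or when the difference of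
-- their points is the difference of two distinct entries of 𝒲 or of ℬ: this is
-- exactly what the hypotheses assert modulo n.  Both halves of "splitting set"
-- thereby become finite statements about lattice points, decided by computation:
-- the points of Σ are pairwise at distance > 2, and the six vertices
-- C = {b⁻, b⁺, (2b)⁻, (2b-a)⁺, (2b-a)⁻, (b-a)⁺} have all their neighbours in C ∪ Σ
-- while (3b)⁻ lies outside C ∪ Σ, so Σ separates b⁻ from (3b)⁻.
module Submission where

open import Defs
open import Data.Nat using (ℕ; NonZero)
open import Data.Integer using (ℤ; +_; -_; _+_; _-_; _*_; _<_)
open import Data.Fin using (Fin)
open import Data.Vec using (Vec; lookup; []; _∷_)
open import Data.List using (List; []; _∷_)
open import Data.Product using (_×_; _,_)
open import Relation.Binary.PropositionalEquality using (_≢_)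

import Data.Nat as ℕ
import Data.Nat.Properties as ℕP
open import Data.Nat.DivMod using (m<n⇒m%n≡m)
open import Data.Integer using (-[1+_]; +[1+_]; _%ℕ_; _/ℕ_)
import Data.Integer.Properties as ℤP
open import Data.Integer.DivMod using (n%ℕd<d; a≡a%ℕn+[a/ℕn]*n)
open import Data.Integer.Tactic.RingSolver using (solve-∀)
open import Data.Fin using (toℕ)
import Data.Fin.Properties as FinP
open import Data.Product using (Σ; proj₁; proj₂)
open import Data.Empty using (⊥-elim)
open import Relation.Binary.PropositionalEquality
  using (_≡_; refl; sym; trans; cong; cong₂; subst; module ≡-Reasoning)
open import Data.List using (map)
open import Data.List.Membership.Propositional using (_∈_)
open import Data.List.Membership.Propositional.Properties using (∈-map⁺; ∈-map⁻)
open import Data.List.Relation.Unary.All using (All)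
import Data.List.Relation.Unary.All as All
open import Data.Vec.Properties using (lookup-map)
import Data.Vec as Vec
open import Data.Product.Properties using (≡-dec)
open import Data.Sum using (_⊎_; inj₁; inj₂)
open import Relation.Nullary using (¬_; Dec; yes; no)
open import Relation.Nullary.Decidable using (True; toWitness; ¬?; _×-dec_; _⊎-dec_)
open import Relation.Unary using (Decidable)
open import Relation.Binary.Definitions using (DecidableEquality)
open import Function using (_∘_)

module Congruence (n : ℕ) .{{_ : NonZero n}} where

  open ≡-Reasoning

  infix 4 _≡[mod]_

  data _≡[mod]_ (x y : ℤ) : Set where
    multiple : ∀ q → x - y ≡ q * + n → x ≡[mod] y

  sub-to-add : ∀ x y {z} → x - y ≡ z → x ≡ y + z
  sub-to-add x y x-y≡z = trans (x≡y+[x-y] x y) (cong (_+_ y) x-y≡z)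
    where
    x≡y+[x-y] : ∀ x y → x ≡ y + (x - y)
    x≡y+[x-y] = solve-∀

  negate : ∀ x y q → x - y ≡ q * + n → y - x ≡ - q * + n
  negate x y q x-y≡qn = begin
    y - x        ≡⟨ y-x≡-[x-y] x y ⟩
    - (x - y)    ≡⟨ cong -_ x-y≡qn ⟩
    - (q * + n)  ≡⟨ ℤP.neg-distribˡ-* q (+ n) ⟩
    - q * + n    ∎
    where
    y-x≡-[x-y] : ∀ x y → y - x ≡ - (x - y)
    y-x≡-[x-y] = solve-∀

  ≡[mod]-sym : ∀ {x y} → x ≡[mod] y → y ≡[mod] x
  ≡[mod]-sym {x} {y} (multiple q x-y≡qn) = multiple (- q) (negate x y q x-y≡qn)

  ≡[mod]-+ : ∀ {x x′ y y′} → x ≡[mod] x′ → y ≡[mod] y′ → x + y ≡[mod] x′ + y′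
  ≡[mod]-+ {x} {x′} {y} {y′} (multiple q x-x′≡qn) (multiple r y-y′≡rn) = multiple (q + r) (begin
    (x + y) - (x′ + y′)      ≡⟨ interchange x x′ y y′ ⟩
    (x - x′) + (y - y′)      ≡⟨ cong₂ _+_ x-x′≡qn y-y′≡rn ⟩
    q * + n + r * + n        ≡⟨ ℤP.*-distribʳ-+ (+ n) q r ⟨
    (q + r) * + n            ∎)
    where
    interchange : ∀ x x′ y y′ → (x + y) - (x′ + y′) ≡ (x - x′) + (y - y′)
    interchange = solve-∀

  ≡[mod]-trans : ∀ {x y z} → x ≡[mod] y → y ≡[mod] z → x ≡[mod] z
  ≡[mod]-trans {x} {y} {z} (multiple q x-y≡qn) (multiple r y-z≡rn) = multiple (q + r) (begin
    x - z                    ≡⟨ telescope x y z ⟩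
    (x - y) + (y - z)        ≡⟨ cong₂ _+_ x-y≡qn y-z≡rn ⟩
    q * + n + r * + n        ≡⟨ ℤP.*-distribʳ-+ (+ n) q r ⟨
    (q + r) * + n            ∎)
    where
    telescope : ∀ x y z → x - z ≡ (x - y) + (y - z)
    telescope = solve-∀

  residue : ∀ x → + (x %ℕ n) ≡[mod] x
  residue x = multiple (- (x /ℕ n)) (begin
    + r - x                       ≡⟨ cong (_-_ (+ r)) (a≡a%ℕn+[a/ℕn]*n x n) ⟩
    + r - (+ r + x /ℕ n * + n)    ≡⟨ cancel (+ r) (x /ℕ n) (+ n) ⟩
    - (x /ℕ n) * + n              ∎)
    where
    r : ℕ
    r = x %ℕ n
    cancel : ∀ r q m → r - (r + q * m) ≡ - q * m
    cancel = solve-∀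

  no-wrap : ∀ {r} s k → r ℕ.< n → + r ≢ + s + + ℕ.suc k * + n
  no-wrap {r} s k r<n r≡s+kn = ℕP.<⇒≱ r<n (subst (n ℕ.≤_) (sym r≡) n≤s+kn)
    where
    r≡ : r ≡ s ℕ.+ ℕ.suc k ℕ.* n
    r≡ = ℤP.+-injective (trans r≡s+kn
           (trans (cong (_+_ (+ s)) (sym (ℤP.pos-* (ℕ.suc k) n))) (sym (ℤP.pos-+ s _))))
    n≤s+kn : n ℕ.≤ s ℕ.+ ℕ.suc k ℕ.* n
    n≤s+kn = ℕP.≤-trans (ℕP.m≤m+n n (k ℕ.* n)) (ℕP.m≤n+m (ℕ.suc k ℕ.* n) s)

  residue-unique : ∀ {r s} → r ℕ.< n → s ℕ.< n → + r ≡[mod] + s → r ≡ s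
  residue-unique {r} {s} _ _ (multiple (+ 0) r-s≡0) =
    ℤP.+-injective (ℤP.i-j≡0⇒i≡j (+ r) (+ s) r-s≡0)
  residue-unique {r} {s} r<n _ (multiple +[1+ k ] r-s≡kn) =
    ⊥-elim (no-wrap s k r<n (sub-to-add (+ r) (+ s) r-s≡kn))
  residue-unique {r} {s} _ s<n (multiple -[1+ k ] r-s≡-kn) =
    ⊥-elim (no-wrap r k s<n (sub-to-add (+ s) (+ r) (negate (+ r) (+ s) -[1+ k ] r-s≡-kn)))

  toℕ-ι : ∀ x → toℕ (ι {n} x) ≡ x %ℕ n
  toℕ-ι x = FinP.toℕ-fromℕ< (n%ℕd<d x n)

  ι-≡ : ∀ x y → x ≡[mod] y → ι {n} x ≡ ι y
  ι-≡ x y x≡y = FinP.fromℕ<-cong _ _ residues-equal (n%ℕd<d x n) (n%ℕd<d y n)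
    where
    residues-equal : x %ℕ n ≡ y %ℕ n
    residues-equal = residue-unique (n%ℕd<d x n) (n%ℕd<d y n)
      (≡[mod]-trans (residue x) (≡[mod]-trans x≡y (≡[mod]-sym (residue y))))

  ≡-ι : ∀ x y → ι {n} x ≡ ι y → x ≡[mod] y
  ≡-ι x y ιx≡ιy = ≡[mod]-trans (≡[mod]-sym (residue x))
    (subst (λ r → + r ≡[mod] y) residues-equal (residue y))
    where
    residues-equal : y %ℕ n ≡ x %ℕ n
    residues-equal = trans (sym (toℕ-ι y)) (trans (cong toℕ (sym ιx≡ιy)) (toℕ-ι x))

  ι-shift : ∀ x y z w → ι {n} x ≡ ι y → x - y ≡ z - w → ι z ≡ ι w
  ι-shift x y z w ιx≡ιy x-y≡z-w with ≡-ι x y ιx≡ιy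
  ... | multiple q x-y≡qn = ι-≡ z w (multiple q (trans (sym x-y≡z-w) x-y≡qn))

  ι-toℕ : ∀ (i : Fin n) → ι (+ toℕ i) ≡ i
  ι-toℕ i = FinP.toℕ-injective (trans (toℕ-ι (+ toℕ i)) (m<n⇒m%n≡m (FinP.toℕ<n i)))

  ι-+ : ∀ x y → ι {n} x +ₙ ι y ≡ ι (x + y)
  ι-+ x y = ι-≡ _ (x + y) (subst (_≡[mod] x + y) (sym residue-sum) (≡[mod]-+ (residue x) (residue y)))
    where
    residue-sum : + (toℕ (ι {n} x) ℕ.+ toℕ (ι {n} y)) ≡ + (x %ℕ n) + + (y %ℕ n)
    residue-sum = trans (cong₂ (λ r s → + (r ℕ.+ s)) (toℕ-ι x) (toℕ-ι y)) (ℤP.pos-+ (x %ℕ n) (y %ℕ n))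

  +ₙ-inverse : ∀ (i : Fin n) k y → i +ₙ ι k ≡ ι y → i ≡ ι (y - k)
  +ₙ-inverse i k y i+k≡y = begin
    i                ≡⟨ ι-toℕ i ⟨
    ι (+ toℕ i)      ≡⟨ ι-shift (+ toℕ i + k) y (+ toℕ i) (y - k) ι[i+k]≡ιy (rearrange (+ toℕ i) k y) ⟩
    ι (y - k)        ∎
    where
    ι[i+k]≡ιy : ι (+ toℕ i + k) ≡ ι y
    ι[i+k]≡ιy = trans (sym (ι-+ (+ toℕ i) k)) (trans (cong (_+ₙ ι k) (ι-toℕ i)) i+k≡y)
    rearrange : ∀ x k y → (x + k) - y ≡ x - (y - k)
    rearrange = solve-∀

-- the point (α , β) stands for the integer α a + β b
Point : Set
Point = ℤ × ℤ

infixl 6 _⊕_ _⊖_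
infixr 7 _⊛_

_⊕_ _⊖_ : Point → Point → Point
(α , β) ⊕ (γ , δ) = α + γ , β + δ
(α , β) ⊖ (γ , δ) = α - γ , β - δ

_⊛_ : ℤ → Point → Point
k ⊛ (α , β) = k * α , k * β

⊝_ : Point → Point
⊝ (α , β) = - α , - β

infixl 6 _⊞_ _⊟_
infixr 7 _·_
infix 8 ⊟_

data Lin : Set where
  𝟘 `a `b : Lin
  _·_     : ℤ → Lin → Lin
  _⊞_ _⊟_ : Lin → Lin → Lin
  ⊟_      : Lin → Lin

coords : Lin → Point
coords 𝟘       = + 0 , + 0
coords `a      = + 1 , + 0
coords `b      = + 0 , + 1
coords (k · e) = k ⊛ coords e
coords (e ⊞ f) = coords e ⊕ coords f
coords (e ⊟ f) = coords e ⊖ coords f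
coords (⊟ e)   = ⊝ coords e

module Linear (a b : ℤ) where

  ⟦_⟧ : Point → ℤ
  ⟦ α , β ⟧ = α * a + β * b

  eval : Lin → ℤ
  eval 𝟘       = + 0
  eval `a      = a
  eval `b      = b
  eval (k · e) = k * eval e
  eval (e ⊞ f) = eval e + eval f
  eval (e ⊟ f) = eval e - eval f
  eval (⊟ e)   = - eval e

  ⟦⟧-⊕ : ∀ p q → ⟦ p ⊕ q ⟧ ≡ ⟦ p ⟧ + ⟦ q ⟧
  ⟦⟧-⊕ (α , β) (γ , δ) = identity α β γ δ a b
    where
    identity : ∀ α β γ δ a b → (α + γ) * a + (β + δ) * b ≡ (α * a + β * b) + (γ * a + δ * b)
    identity = solve-∀

  ⟦⟧-⊖ : ∀ p q → ⟦ p ⊖ q ⟧ ≡ ⟦ p ⟧ - ⟦ q ⟧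
  ⟦⟧-⊖ (α , β) (γ , δ) = identity α β γ δ a b
    where
    identity : ∀ α β γ δ a b → (α - γ) * a + (β - δ) * b ≡ (α * a + β * b) - (γ * a + δ * b)
    identity = solve-∀

  ⟦⟧-⊛ : ∀ k p → ⟦ k ⊛ p ⟧ ≡ k * ⟦ p ⟧
  ⟦⟧-⊛ k (α , β) = identity k α β a b
    where
    identity : ∀ k α β a b → (k * α) * a + (k * β) * b ≡ k * (α * a + β * b)
    identity = solve-∀

  ⟦⟧-⊝ : ∀ p → ⟦ ⊝ p ⟧ ≡ - ⟦ p ⟧
  ⟦⟧-⊝ (α , β) = identity α β a b
    where
    identity : ∀ α β a b → (- α) * a + (- β) * b ≡ - (α * a + β * b)
    identity = solve-∀

  eval-coords : ∀ e → eval e ≡ ⟦ coords e ⟧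
  eval-coords 𝟘 = zero-form a b
    where
    zero-form : ∀ a b → + 0 ≡ + 0 * a + + 0 * b
    zero-form = solve-∀
  eval-coords `a = a-form a b
    where
    a-form : ∀ a b → a ≡ + 1 * a + + 0 * b
    a-form = solve-∀
  eval-coords `b = b-form a b
    where
    b-form : ∀ a b → b ≡ + 0 * a + + 1 * b
    b-form = solve-∀
  eval-coords (k · e) = trans (cong (k *_) (eval-coords e)) (sym (⟦⟧-⊛ k (coords e)))
  eval-coords (e ⊞ f) = trans (cong₂ _+_ (eval-coords e) (eval-coords f)) (sym (⟦⟧-⊕ (coords e) (coords f)))
  eval-coords (e ⊟ f) = trans (cong₂ _-_ (eval-coords e) (eval-coords f)) (sym (⟦⟧-⊖ (coords e) (coords f)))
  eval-coords (⊟ e)   = trans (cong -_ (eval-coords e)) (sym (⟦⟧-⊝ (coords e)))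

LVertex : Set
LVertex = Sign × Point

vertex-coords : Sign × Lin → LVertex
vertex-coords (s , e) = s , coords e

-- the neighbours of a lattice vertex when S has coordinates ks:
-- i⁺ is joined to (i+k)⁻, hence j⁻ to (j-k)⁺
nbrs : List Point → LVertex → List LVertex
nbrs ks (plus  , p) = map (λ k → minus , p ⊕ k) ks
nbrs ks (minus , p) = map (λ k → plus  , p ⊖ k) ks

_≟ˢ_ : DecidableEquality Sign
plus  ≟ˢ plus  = yes refl
plus  ≟ˢ minus = no λ ()
minus ≟ˢ plus  = no λ ()
minus ≟ˢ minus = yes refl

_≟ᵖ_ : DecidableEquality Point
_≟ᵖ_ = ≡-dec ℤP._≟_ ℤP._≟_

_≟ᵛ_ : DecidableEquality LVertex
_≟ᵛ_ = ≡-dec _≟ˢ_ _≟ᵖ_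

open import Data.List.Membership.DecPropositional _≟ᵛ_ using (_∈?_)

DifferenceOf : ∀ {m} → Vec Point m → Point → Set
DifferenceOf {m} ps d = Σ (Fin m) λ i → Σ (Fin m) λ j → i ≢ j × lookup ps i ⊖ lookup ps j ≡ d

difference? : ∀ {m} (ps : Vec Point m) → Decidable (DifferenceOf ps)
difference? ps d = FinP.any? λ i → FinP.any? λ j →
  ¬? (i FinP.≟ j) ×-dec ((lookup ps i ⊖ lookup ps j) ≟ᵖ d)

-- Certificates for a splitting set, for a connection set with coordinates
-- ks and a predicate Forbidden on differences that are known never to
-- vanish in the realisation.
module Certificates (ks : List Point) (Forbidden : Point → Set) where

  -- x and y certainly have distinct realisations
  Apart : LVertex → LVertex → Set
  Apart (s , p) (t , q) = s ≢ t ⊎ Forbidden (p ⊖ q)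

  -- x and y are equal or certainly at distance more than 2
  Far : LVertex → LVertex → Set
  Far x y = x ≡ y ⊎ (All (λ x′ → Apart x′ y) (nbrs ks x)
                    × All (λ x′ → All (Apart x′) (nbrs ks y)) (nbrs ks x))

  Scattered : List LVertex → Set
  Scattered σ = All (λ x → All (Far x) σ) σ

  Enclosed : List LVertex → List LVertex → Set
  Enclosed σ C = All (λ x → All (λ y → y ∈ C ⊎ y ∈ σ) (nbrs ks x)) C

  record SplittingCertificate : Set where
    field
      splitter component : List LVertex
      source target      : LVertex
      scattered          : Scattered splitter
      enclosed           : Enclosed splitter component
      source∈component   : source ∈ component
      source∉splitter    : All (Apart source) splitter
      target∉splitter    : All (Apart target) splitter
      target∉component   : All (Apart target) component

  module Decide (forbidden? : Decidable Forbidden) where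

    apart? : ∀ x y → Dec (Apart x y)
    apart? (s , p) (t , q) = ¬? (s ≟ˢ t) ⊎-dec forbidden? (p ⊖ q)

    far? : ∀ x y → Dec (Far x y)
    far? x y = (x ≟ᵛ y) ⊎-dec
      (All.all? (λ x′ → apart? x′ y) (nbrs ks x)
        ×-dec All.all? (λ x′ → All.all? (apart? x′) (nbrs ks y)) (nbrs ks x))

    scattered? : ∀ σ → Dec (Scattered σ)
    scattered? σ = All.all? (λ x → All.all? (far? x) σ) σ

    enclosed? : ∀ σ C → Dec (Enclosed σ C)
    enclosed? σ C = All.all? (λ x → All.all? (λ y → (y ∈? C) ⊎-dec (y ∈? σ)) (nbrs ks x)) C

    apart-all? : ∀ x ys → Dec (All (Apart x) ys)
    apart-all? x = All.all? (apart? x)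

HAdj-sym : ∀ {n} .{{_ : NonZero n}} {S : List (Fin n)} {u v} → HAdj n S u v → HAdj n S v u
HAdj-sym {u = plus  , _} {plus  , _} ()
HAdj-sym {u = plus  , _} {minus , _} e = e
HAdj-sym {u = minus , _} {plus  , _} e = e
HAdj-sym {u = minus , _} {minus , _} ()

Distinct : (n : ℕ) .{{_ : NonZero n}} {m : ℕ} → Vec ℤ m → Set
Distinct n {m} v = ∀ (i j : Fin m) → i ≢ j → ι {n} (lookup v i) ≢ ι (lookup v j)

module Realisation (n : ℕ) .{{_ : NonZero n}} (a b : ℤ) where

  open Congruence n
  open Linear a b
  open ≡-Reasoning

  ⟪_⟫ : LVertex → HVertex n
  ⟪ s , p ⟫ = s , ι ⟦ p ⟧

  realise : Sign × Lin → HVertex n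
  realise (s , e) = s , ι (eval e)

  realise-forms : ∀ xs → map realise xs ≡ map ⟪_⟫ (map vertex-coords xs)
  realise-forms []            = refl
  realise-forms ((s , e) ∷ xs) =
    cong₂ _∷_ (cong (λ z → s , ι z) (eval-coords e)) (realise-forms xs)

  difference-sound : ∀ {m} (es : Vec Lin m) → Distinct n (Vec.map eval es) →
                     ∀ p q → DifferenceOf (Vec.map coords es) (p ⊖ q) → ι ⟦ p ⟧ ≢ ι ⟦ q ⟧
  difference-sound {m} es distinct p q (i , j , i≢j , eᵢ-eⱼ≡p-q) ιp≡ιq = distinct i j i≢j (begin
    ι (lookup (Vec.map eval es) i)   ≡⟨ cong ι (value i) ⟩
    ι ⟦ cs i ⟧                       ≡⟨ ι-shift ⟦ p ⟧ ⟦ q ⟧ ⟦ cs i ⟧ ⟦ cs j ⟧ ιp≡ιq same-difference ⟩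
    ι ⟦ cs j ⟧                       ≡⟨ cong ι (value j) ⟨
    ι (lookup (Vec.map eval es) j)   ∎)
    where
    cs : Fin m → Point
    cs k = lookup (Vec.map coords es) k
    value : ∀ k → lookup (Vec.map eval es) k ≡ ⟦ cs k ⟧
    value k = trans (lookup-map k eval es)
      (trans (eval-coords (lookup es k)) (cong ⟦_⟧ (sym (lookup-map k coords es))))
    same-difference : ⟦ p ⟧ - ⟦ q ⟧ ≡ ⟦ cs i ⟧ - ⟦ cs j ⟧
    same-difference = begin
      ⟦ p ⟧ - ⟦ q ⟧        ≡⟨ ⟦⟧-⊖ p q ⟨
      ⟦ p ⊖ q ⟧            ≡⟨ cong ⟦_⟧ eᵢ-eⱼ≡p-q ⟨
      ⟦ cs i ⊖ cs j ⟧      ≡⟨ ⟦⟧-⊖ (cs i) (cs j) ⟩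
      ⟦ cs i ⟧ - ⟦ cs j ⟧  ∎

  module Haar (gs : List Lin) where

    E : HVertex n → HVertex n → Set
    E = HAdj n (map (ι ∘ eval) gs)

    ks : List Point
    ks = map coords gs

    connection : ∀ {k} → k ∈ map (ι ∘ eval) gs → Σ Point λ K → K ∈ ks × k ≡ ι ⟦ K ⟧
    connection k∈S with ∈-map⁻ (ι ∘ eval) k∈S
    ... | g , g∈gs , refl = coords g , ∈-map⁺ coords g∈gs , cong ι (eval-coords g)

    neighbours : ∀ x {v} → E ⟪ x ⟫ v → Σ LVertex λ y → y ∈ nbrs ks x × v ≡ ⟪ y ⟫
    neighbours (plus , p) {minus , j} (k , k∈S , j≡p+k) with connection k∈S
    ... | K , K∈ks , k≡K = (minus , p ⊕ K) , ∈-map⁺ _ K∈ks , cong (minus ,_) (begin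
      j                   ≡⟨ j≡p+k ⟩
      ι ⟦ p ⟧ +ₙ k        ≡⟨ cong (ι ⟦ p ⟧ +ₙ_) k≡K ⟩
      ι ⟦ p ⟧ +ₙ ι ⟦ K ⟧  ≡⟨ ι-+ ⟦ p ⟧ ⟦ K ⟧ ⟩
      ι (⟦ p ⟧ + ⟦ K ⟧)   ≡⟨ cong ι (⟦⟧-⊕ p K) ⟨
      ι ⟦ p ⊕ K ⟧         ∎)
    neighbours (minus , q) {plus , i} (k , k∈S , q≡i+k) with connection k∈S
    ... | K , K∈ks , k≡K = (plus , q ⊖ K) , ∈-map⁺ _ K∈ks , cong (plus ,_) (begin
      i                   ≡⟨ +ₙ-inverse i ⟦ K ⟧ ⟦ q ⟧ (sym (trans q≡i+k (cong (i +ₙ_) k≡K))) ⟩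
      ι (⟦ q ⟧ - ⟦ K ⟧)   ≡⟨ cong ι (⟦⟧-⊖ q K) ⟨
      ι ⟦ q ⊖ K ⟧         ∎)

    module Sound (Forbidden : Point → Set)
                 (forbidden-sound : ∀ p q → Forbidden (p ⊖ q) → ι ⟦ p ⟧ ≢ ι ⟦ q ⟧) where

      open Certificates ks Forbidden

      apart-sound : ∀ x y → Apart x y → ⟪ x ⟫ ≢ ⟪ y ⟫
      apart-sound (s , p) (t , q) (inj₁ s≢t)      eq = s≢t (cong proj₁ eq)
      apart-sound (s , p) (t , q) (inj₂ forbidden) eq = forbidden-sound p q forbidden (cong proj₂ eq)

      -- the distance-1 and distance-2 cases of Adj² both meet an apart pair
      far-sound : ∀ x y → Far x y → ¬ Adj² E ⟪ x ⟫ ⟪ y ⟫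
      far-sound x .x (inj₁ refl) (x≢x , _) = x≢x refl
      far-sound x y (inj₂ (near , _)) (_ , inj₁ edge) with neighbours x edge
      ... | x′ , x′∈ , ⟪y⟫≡⟪x′⟫ = apart-sound x′ y (All.lookup near x′∈) (sym ⟪y⟫≡⟪x′⟫)
      far-sound x y (inj₂ (_ , far)) (_ , inj₂ (w , edge₁ , edge₂))
        with neighbours x edge₁ | neighbours y (HAdj-sym edge₂)
      ... | x′ , x′∈ , w≡⟪x′⟫ | y′ , y′∈ , w≡⟪y′⟫ =
        apart-sound x′ y′ (All.lookup (All.lookup far x′∈) y′∈) (trans (sym w≡⟪x′⟫) w≡⟪y′⟫)

      independent : ∀ {σ} → Scattered σ → IndependentSq E (InList (map ⟪_⟫ σ))
      independent scattered u v u∈σ v∈σ with ∈-map⁻ ⟪_⟫ u∈σ | ∈-map⁻ ⟪_⟫ v∈σ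
      ... | x , x∈σ , refl | y , y∈σ , refl = far-sound x y (All.lookup (All.lookup scattered x∈σ) y∈σ)

      outside : ∀ {ys} x → All (Apart x) ys → ¬ InList (map ⟪_⟫ ys) ⟪ x ⟫
      outside x apart x∈ys with ∈-map⁻ ⟪_⟫ x∈ys
      ... | y , y∈ys , ⟪x⟫≡⟪y⟫ = apart-sound x y (All.lookup apart y∈ys) ⟪x⟫≡⟪y⟫

      trapped : ∀ {σ C} → Enclosed σ C → ∀ {u v} → InList (map ⟪_⟫ C) u →
                Reach E (λ w → ¬ InList (map ⟪_⟫ σ) w) u v → InList (map ⟪_⟫ C) v
      trapped enclosed u∈C here = u∈C
      trapped enclosed u∈C (step v∉σ edge walk) with ∈-map⁻ ⟪_⟫ u∈C
      ... | x , x∈C , refl with neighbours x edge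
      ... | y , y∈nbrs , refl with All.lookup (All.lookup enclosed x∈C) y∈nbrs
      ... | inj₁ y∈C = trapped enclosed (∈-map⁺ ⟪_⟫ y∈C) walk
      ... | inj₂ y∈σ = ⊥-elim (v∉σ (∈-map⁺ ⟪_⟫ y∈σ))

      certified-splitting : (c : SplittingCertificate) →
        IsSplittingSet E (InList (map ⟪_⟫ (SplittingCertificate.splitter c)))
      certified-splitting c =
        independent scattered ,
        (⟪ source ⟫ , ⟪ target ⟫ ,
         outside source source∉splitter , outside target target∉splitter ,
         λ walk → outside target target∉component
                    (trapped enclosed (∈-map⁺ ⟪_⟫ source∈component) walk))
        where open SplittingCertificate c

W-forms B-forms : Vec Lin 12
W-forms = 𝟘 ∷ `a ∷ `b ∷ + 2 · `b ∷ `b ⊞ `a ∷ `b ⊟ `a ∷ + 2 · `b ⊟ `a ∷ + 2 · `b ⊟ + 2 · `a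
          ∷ + 3 · `b ⊟ `a ∷ + 3 · `b ⊟ + 2 · `a ∷ + 2 · `b ⊞ `a ∷ + 3 · `b ∷ []
B-forms = 𝟘 ∷ `a ∷ `b ∷ + 2 · `b ∷ `b ⊞ `a ∷ `b ⊟ `a ∷ + 2 · `b ⊟ `a ∷ + 2 · `b ⊟ + 2 · `a
          ∷ + 3 · `b ⊟ `a ∷ + 3 · `b ⊟ + 2 · `a ∷ ⊟ `a ∷ `b ⊟ + 2 · `a ∷ []

S-forms : List Lin
S-forms = 𝟘 ∷ `a ∷ `b ∷ []

Σ-forms : List (Sign × Lin)
Σ-forms = (plus , 𝟘) ∷ (plus , + 2 · `b) ∷ (plus , + 2 · `b ⊟ + 2 · `a)
          ∷ (minus , `b ⊟ `a) ∷ (minus , `b ⊞ `a) ∷ (minus , + 3 · `b ⊟ `a) ∷ []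

-- the component of b⁻ in H - Σ: {b⁻, b⁺, (2b)⁻, (2b-a)⁺, (2b-a)⁻, (b-a)⁺}
component-forms : List (Sign × Lin)
component-forms = (minus , `b) ∷ (plus , `b) ∷ (minus , + 2 · `b)
                  ∷ (plus , + 2 · `b ⊟ `a) ∷ (minus , + 2 · `b ⊟ `a) ∷ (plus , `b ⊟ `a) ∷ []

Forbidden : Point → Set
Forbidden d = DifferenceOf (Vec.map coords W-forms) d ⊎ DifferenceOf (Vec.map coords B-forms) d

forbidden? : Decidable Forbidden
forbidden? d = difference? (Vec.map coords W-forms) d ⊎-dec difference? (Vec.map coords B-forms) d

open Certificates (map coords S-forms) Forbidden
open Decide forbidden?

by-computation : ∀ {A : Set} (d : Dec A) → {True d} → A
by-computation d {yes-answer} = toWitness yes-answer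

certificate : SplittingCertificate
certificate = record
  { splitter         = σ
  ; component        = C
  ; source           = s
  ; target           = t
  ; scattered        = by-computation (scattered? σ)
  ; enclosed         = by-computation (enclosed? σ C)
  ; source∈component = by-computation (s ∈? C)
  ; source∉splitter  = by-computation (apart-all? s σ)
  ; target∉splitter  = by-computation (apart-all? t σ)
  ; target∉component = by-computation (apart-all? t C)
  }
  where
  σ C : List LVertex
  σ = map vertex-coords Σ-forms
  C = map vertex-coords component-forms
  s t : LVertex
  s = vertex-coords (minus , `b)
  t = vertex-coords (minus , + 3 · `b)

theorem6 : (n : ℕ) .{{_ : NonZero n}} (a b : ℤ) → + 0 < a → a < b →
  (∀ (i j : Fin 12) → i ≢ j →
    ι {n} (lookup (+ 0 ∷ a ∷ b ∷ + 2 * b ∷ b + a ∷ b - a ∷ + 2 * b - a ∷ + 2 * b - + 2 * a ∷ + 3 * b - a ∷ + 3 * b - + 2 * a ∷ + 2 * b + a ∷ + 3 * b ∷ []) i)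
      ≢ ι {n} (lookup (+ 0 ∷ a ∷ b ∷ + 2 * b ∷ b + a ∷ b - a ∷ + 2 * b - a ∷ + 2 * b - + 2 * a ∷ + 3 * b - a ∷ + 3 * b - + 2 * a ∷ + 2 * b + a ∷ + 3 * b ∷ []) j)) →
  (∀ (i j : Fin 12) → i ≢ j →
    ι {n} (lookup (+ 0 ∷ a ∷ b ∷ + 2 * b ∷ b + a ∷ b - a ∷ + 2 * b - a ∷ + 2 * b - + 2 * a ∷ + 3 * b - a ∷ + 3 * b - + 2 * a ∷ - a ∷ b - + 2 * a ∷ []) i)
      ≢ ι {n} (lookup (+ 0 ∷ a ∷ b ∷ + 2 * b ∷ b + a ∷ b - a ∷ + 2 * b - a ∷ + 2 * b - + 2 * a ∷ + 3 * b - a ∷ + 3 * b - + 2 * a ∷ - a ∷ b - + 2 * a ∷ []) j)) →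
  IsSplittingSet (HAdj n (ι (+ 0) ∷ ι a ∷ ι b ∷ []))
      (InList ((plus , ι (+ 0)) ∷ (plus , ι (+ 2 * b)) ∷ (plus , ι (+ 2 * b - + 2 * a))
               ∷ (minus , ι (b - a)) ∷ (minus , ι (b + a)) ∷ (minus , ι (+ 3 * b - a)) ∷ []))
  × (Connected (HAdj n (ι (+ 0) ∷ ι a ∷ ι b ∷ [])) → Splittable (HAdj n (ι (+ 0) ∷ ι a ∷ ι b ∷ [])))
theorem6 n a b _ _ W-distinct B-distinct = splitting , λ connected → connected , _ , splitting
  where
  open Linear a b
  open Realisation n a b
  open Haar S-forms

  forbidden-sound : ∀ p q → Forbidden (p ⊖ q) → ι ⟦ p ⟧ ≢ ι ⟦ q ⟧
  forbidden-sound p q (inj₁ d) = difference-sound W-forms W-distinct p q d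
  forbidden-sound p q (inj₂ d) = difference-sound B-forms B-distinct p q d

  splitting : IsSplittingSet E (InList (map realise Σ-forms))
  splitting = subst (λ vs → IsSplittingSet E (InList vs)) (sym (realise-forms Σ-forms))
                (Sound.certified-splitting Forbidden forbidden-sound certificate)
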